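{- Let $m,t,B,N\in \mathbb{Z}$ with $m,N>0$ and $B \neq 0$. Write $m=2^u3^vm'$ and $B=2^r3^sB'$ with $\gcd(m',6)=\gcd(B',6)=1$, and define $Q_{m,B}:=2^\alpha3^\beta m'$, where $\alpha := 0$ if $r=0$, $\alpha:=\min(r,u)$ if $r \in\{1,2\}$, $\alpha := u$ if $r\geq 3$; and $\beta := 0$ if $s=0$, $\beta := v$ if $s\geq 1$. Suppose that $\lambda$ is an integer with $0\leq \lambda < m/Q_{m,B}$. Then there exists an integer $a$ with $\gcd(a,6mN)=1$ and $$t+\lambda Q_{m,B} \equiv ta^2 + B\frac{a^2-1}{24} \pmod{m}.$$ -}

module Defs where

open import Data.Nat as ℕ using (ℕ; zero; suc; _⊓_)
open import Data.Integer using (ℤ; +_; _*_; _^_)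

-- α as defined in the paper, from r (2-adic valuation of B) and u (of m):
-- α = 0 if r = 0;  α = min(r,u) if r ∈ {1,2};  α = u if r ≥ 3.
alpha : ℕ → ℕ → ℕ
alpha zero                u = 0
alpha (suc zero)          u = 1 ⊓ u
alpha (suc (suc zero))    u = 2 ⊓ u
alpha (suc (suc (suc _))) u = u

beta : ℕ → ℕ → ℕ
beta zero    v = 0
beta (suc _) v = v

Q : (u v r s : ℕ) → (m' : ℤ) → ℤ
Q u v r s m' = (+ 2) ^ alpha r u * (+ 3) ^ beta s v * m'

-- Take a = 1 + 12j, so that (a² − 1)/24 = j(1 + 6j) and the congruence becomes
-- λQ ≡ (24t + B)·j(1 + 6j) (mod m). Multiplying 24t + B by a suitable P (a power of 2
-- times 3^β) gives 2^α 3^β W, where W is prime to 2 (to 3) whenever the factor 2^a (3^b)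
-- of m/Q = 2^a 3^b is nontrivial. With j = m'PN'Y, N' the part of N prime to 6, the
-- congruence reduces to WN'·Y(1 + 6m'PN'Y) ≡ λ (mod 2^a 3^b), which is solved 6-adically
-- by iterating a contraction, after inverting WN'. As m' and N' divide j, a is prime to 6mN.
module Submission where

open import Data.Nat as ℕ using (ℕ; zero; suc; _⊓_)
import Data.Nat.Properties as ℕ
import Data.Nat.Divisibility as ℕ
import Data.Nat.Coprimality as ℕ
import Data.Nat.Induction as ℕ
open import Data.Nat.Primality using (Prime; prime?; prime[2]; ¬prime[1]; euclidsLemma)
open import Data.Integer
  using (ℤ; +_; _+_; _-_; _*_; _^_; -_; ∣_∣; 0ℤ; 1ℤ; _/_; _%_; _≤_; _<_; ≢-nonZero)
open import Data.Integer.Properties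
  using ( +-identityˡ; *-identityˡ; *-identityʳ; *-zeroʳ; *-comm; *-assoc; *-cancelʳ-≡
        ; abs-*; <⇒≢; ^-distribˡ-+-*)
open import Data.Integer.DivMod using (a≡a%n+[a/n]*n; n%d<d)
open import Data.Integer.Divisibility.Signed
import Data.Integer.Divisibility as Unsigned
open import Data.Integer.Coprimality using (Coprime)
open import Data.Integer.GCD using (gcd; gcd-greatest)
open import Data.Integer.Tactic.RingSolver using (solve-∀)
open import Data.Product using (∃; ∃₂; _×_; _,_)
open import Data.Sum using (inj₁; inj₂)
open import Induction.WellFounded using (Acc; acc)
open import Relation.Nullary using (¬_; contradiction)
open import Relation.Nullary.Decidable using (yes; no; from-yes; from-no)
open import Relation.Binary.PropositionalEquality

open import Defs using (alpha; beta; Q)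

i*d/d≡i : ∀ i d .{{_ : ℕ.NonZero d}} → (i * + d) / + d ≡ i
i*d/d≡i i d = sym (*-cancelʳ-≡ i q (+ d) (begin
  i * + d        ≡⟨ a≡a%n+[a/n]*n (i * + d) (+ d) ⟩
  + r + q * + d  ≡⟨ cong (λ r → + r + q * + d) r≡0 ⟩
  + 0 + q * + d  ≡⟨ +-identityˡ (q * + d) ⟩
  q * + d        ∎))
  where
  open ≡-Reasoning
  q = (i * + d) / + d
  r = (i * + d) % + d
  d∣r : d ℕ.∣ r
  d∣r = ∣⇒∣ᵤ {+ d} {+ r}
    (∣m+n∣n⇒∣m (subst (+ d ∣_) (a≡a%n+[a/n]*n (i * + d) (+ d)) (∣n⇒∣m*n i ∣-refl)) (∣n⇒∣m*n q ∣-refl))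
  ∣∧<⇒≡0 : ∀ {d r} → d ℕ.∣ r → r ℕ.< d → r ≡ 0
  ∣∧<⇒≡0 {r = zero}  _   _   = refl
  ∣∧<⇒≡0 {r = suc _} d∣r r<d = contradiction d∣r (ℕ.>⇒∤ r<d)
  r≡0 : r ≡ 0
  r≡0 = ∣∧<⇒≡0 d∣r (n%d<d (i * + d) (+ d))

by-residue : ∀ d .{{_ : ℕ.NonZero d}} (P : ℤ → Set) →
             (∀ r q → r ℕ.< d → P (+ r + q * + d)) → ∀ x → P x
by-residue d P cases x =
  subst P (sym (a≡a%n+[a/n]*n x (+ d))) (cases (x % + d) (x / + d) (n%d<d x (+ d)))

1∣_ : ∀ i → 1ℤ ∣ i
1∣ i = ∣ᵤ⇒∣ (ℕ.1∣ ∣ i ∣)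

^-monoˡ-∣ : ∀ {i j} n → i ∣ j → i ^ n ∣ j ^ n
^-monoˡ-∣         zero    _   = ∣-refl
^-monoˡ-∣ {i} {j} (suc n) i∣j = ∣-trans (*-monoˡ-∣ (i ^ n) i∣j) (*-monoʳ-∣ j (^-monoˡ-∣ n i∣j))

2^a*3^b∣6^[a+b] : ∀ a b → (+ 2) ^ a * (+ 3) ^ b ∣ (+ 6) ^ (a ℕ.+ b)
2^a*3^b∣6^[a+b] a b = subst ((+ 2) ^ a * (+ 3) ^ b ∣_) (sym (^-distribˡ-+-* (+ 6) a b))
  (∣-trans (*-monoˡ-∣ ((+ 3) ^ b) (^-monoˡ-∣ a (divides (+ 3) refl)))
           (*-monoʳ-∣ ((+ 6) ^ a) (^-monoˡ-∣ b (divides (+ 2) refl))))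

2∣∧3∣⇒6∣ : ∀ {n} → + 2 ∣ n → + 3 ∣ n → + 6 ∣ n
2∣∧3∣⇒6∣ {n} 2∣n 3∣n =
  subst (+ 6 ∣_) (three-minus-two n) (∣m∣n⇒∣m-n (*-monoʳ-∣ (+ 3) 2∣n) (*-monoʳ-∣ (+ 2) 3∣n))
  where
  three-minus-two : ∀ n → + 3 * n - + 2 * n ≡ n
  three-minus-two = solve-∀

p∤1 : ∀ {p} → Prime p → ¬ + p ∣ 1ℤ
p∤1 p-prime p∣1 = ¬prime[1] (subst Prime (ℕ.∣1⇒≡1 (∣⇒∣ᵤ p∣1)) p-prime)

∤-* : ∀ {p} → Prime p → ∀ {i j} → ¬ + p ∣ i → ¬ + p ∣ j → ¬ + p ∣ i * j
∤-* {p} p-prime {i} {j} p∤i p∤j p∣ij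
  with euclidsLemma ∣ i ∣ ∣ j ∣ p-prime (subst (p ℕ.∣_) (abs-* i j) (∣⇒∣ᵤ p∣ij))
... | inj₁ p∣i = p∤i (∣ᵤ⇒∣ p∣i)
... | inj₂ p∣j = p∤j (∣ᵤ⇒∣ p∣j)

∤-^ : ∀ {p} → Prime p → ∀ {i} n → ¬ + p ∣ i → ¬ + p ∣ i ^ n
∤-^ p-prime zero    _   = p∤1 p-prime
∤-^ p-prime (suc n) p∤i = ∤-* p-prime p∤i (∤-^ p-prime n p∤i)

prime[3] : Prime 3
prime[3] = from-yes (prime? 3)

2∤3 : ¬ + 2 ∣ + 3
2∤3 2∣3 = from-no (2 ℕ.∣? 3) (∣⇒∣ᵤ 2∣3)

3∤2 : ¬ + 3 ∣ + 2
3∤2 3∣2 = from-no (3 ℕ.∣? 2) (∣⇒∣ᵤ 3∣2)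

gcd≡1⇒∤ : ∀ i j p → Prime p → + p ∣ j → gcd i j ≡ 1ℤ → ¬ + p ∣ i
gcd≡1⇒∤ i j p p-prime p∣j gcd≡1 p∣i =
  p∤1 p-prime (subst (+ p ∣_) gcd≡1 (∣ᵤ⇒∣ (gcd-greatest {i} {j} {+ p} (∣⇒∣ᵤ p∣i) (∣⇒∣ᵤ p∣j))))

p-free-part : ∀ p .{{_ : ℕ.NonTrivial p}} i → i ≢ 0ℤ →
              ∃₂ λ k j → i ≡ (+ p) ^ k * j × ¬ + p ∣ j
p-free-part p i = go i (ℕ.<-wellFounded ∣ i ∣)
  where
  go : ∀ i → Acc ℕ._<_ ∣ i ∣ → i ≢ 0ℤ → ∃₂ λ k j → i ≡ (+ p) ^ k * j × ¬ + p ∣ j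
  go i (acc rec) i≢0 with + p ∣? i
  ... | no  p∤i = 0 , i , sym (*-identityˡ i) , p∤i
  ... | yes (divides q i≡q*p) =
    let k , j , q≡p^k*j , p∤j = go q (rec ∣q∣<∣i∣) q≢0
    in suc k , j , i≡p^[1+k]*j k j q≡p^k*j , p∤j
    where
    q≢0 : q ≢ 0ℤ
    q≢0 q≡0 = i≢0 (trans i≡q*p (cong (_* + p) q≡0))
    ∣q∣<∣i∣ : ∣ q ∣ ℕ.< ∣ i ∣
    ∣q∣<∣i∣ = subst (∣ q ∣ ℕ.<_) (sym (trans (cong ∣_∣ i≡q*p) (abs-* q (+ p))))
                    (ℕ.m<m*n ∣ q ∣ p {{≢-nonZero q≢0}} (ℕ.nonTrivial⇒n>1 p))
    i≡p^[1+k]*j : ∀ k j → q ≡ (+ p) ^ k * j → i ≡ (+ p) ^ suc k * j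
    i≡p^[1+k]*j k j refl =
      trans i≡q*p (trans (*-comm ((+ p) ^ k * j) (+ p)) (sym (*-assoc (+ p) ((+ p) ^ k) j)))

6-free-part : ∀ i → i ≢ 0ℤ →
              ∃₂ λ x y → ∃ λ j → i ≡ (+ 2) ^ x * (+ 3) ^ y * j × ¬ (+ 2 ∣ j) × ¬ (+ 3 ∣ j)
6-free-part i i≢0 =
  let x , i₁ , i≡2^x*i₁ , 2∤i₁ = p-free-part 2 i i≢0
      y , j , i₁≡3^y*j , 3∤j = p-free-part 3 i₁ (i₁≢0 x i₁ i≡2^x*i₁)
  in x , y , j ,
     trans i≡2^x*i₁ (trans (cong ((+ 2) ^ x *_) i₁≡3^y*j) (sym (*-assoc ((+ 2) ^ x) ((+ 3) ^ y) j))) ,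
     (λ 2∣j → 2∤i₁ (subst (+ 2 ∣_) (sym i₁≡3^y*j) (∣n⇒∣m*n ((+ 3) ^ y) 2∣j))) , 3∤j
  where
  i₁≢0 : ∀ x i₁ → i ≡ (+ 2) ^ x * i₁ → i₁ ≢ 0ℤ
  i₁≢0 x i₁ i≡2^x*i₁ refl = i≢0 (trans i≡2^x*i₁ (*-zeroʳ ((+ 2) ^ x)))

coprime-* : ∀ i j k → Coprime i j → Coprime i k → Coprime i (j * k)
coprime-* i j k i⊥j i⊥k (d∣i , d∣jk) =
  i⊥k (d∣i , ℕ.coprime-divisor (λ (e∣d , e∣j) → i⊥j (ℕ.∣-trans e∣d d∣i , e∣j))
                               (subst (_ ℕ.∣_) (abs-* j k) d∣jk))

coprime-^ : ∀ i j n → Coprime i j → Coprime i (j ^ n)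
coprime-^ i j zero    _   (_ , d∣1) = ℕ.∣1⇒≡1 d∣1
coprime-^ i j (suc n) i⊥j = coprime-* i j (j ^ n) i⊥j (coprime-^ i j n i⊥j)

coprime-2^u*3^v* : ∀ i c u v → Coprime i (+ 2) → Coprime i (+ 3) → Coprime i c →
                   Coprime i ((+ 2) ^ u * (+ 3) ^ v * c)
coprime-2^u*3^v* i c u v i⊥2 i⊥3 i⊥c =
  coprime-* i ((+ 2) ^ u * (+ 3) ^ v) c
    (coprime-* i ((+ 2) ^ u) ((+ 3) ^ v) (coprime-^ i (+ 2) u i⊥2) (coprime-^ i (+ 3) v i⊥3)) i⊥c

coprime-1+ : ∀ x c → c ∣ x → Coprime (1ℤ + x) c
coprime-1+ x c c∣x {d} (d∣1+x , d∣c) =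
  ℕ.∣1⇒≡1 (∣⇒∣ᵤ {+ d} {1ℤ} (∣m+n∣n⇒∣m (∣ᵤ⇒∣ d∣1+x) (∣-trans (∣ᵤ⇒∣ {+ d} {c} d∣c) c∣x)))

coprime⇒gcd≡1 : ∀ i j → Coprime i j → gcd i j ≡ 1ℤ
coprime⇒gcd≡1 i j i⊥j = cong +_ (ℕ.coprime⇒gcd≡1 i⊥j)

approximate-fixed-point : ∀ (F : ℤ → ℤ) d → (∀ x y → d * (x - y) ∣ F x - F y) →
                          ∀ n → ∃ λ x → d ^ n ∣ F x - x
approximate-fixed-point F d contracts n = iterate n , step n
  where
  iterate : ℕ → ℤ
  iterate zero    = 0ℤ
  iterate (suc i) = F (iterate i)
  step : ∀ i → d ^ i ∣ F (iterate i) - iterate i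
  step zero    = 1∣ _
  step (suc i) = ∣-trans (*-monoʳ-∣ d (step i)) (contracts (iterate (suc i)) (iterate i))

InvertibleMod : ℤ → ℤ → Set
InvertibleMod e x = ∃ λ v → e ∣ x * v - 1ℤ

invertible-mod-∣ : ∀ {e f x} → e ∣ f → InvertibleMod f x → InvertibleMod e x
invertible-mod-∣ e∣f (v , f∣xv-1) = v , ∣-trans e∣f f∣xv-1

-- The fixed point of s ↦ 1 − (x² − 1)s is the inverse of x², as a geometric series.
invertible-mod-^ : ∀ d x → d ∣ x * x - 1ℤ → ∀ n → InvertibleMod (d ^ n) x
invertible-mod-^ d x d∣z n =
  let s , d^n∣ = approximate-fixed-point (λ s → 1ℤ - z * s) d contracts n
  in x * s , subst (d ^ n ∣_) (inverse-error x s) (∣m⇒∣-m d^n∣)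
  where
  z = x * x - 1ℤ
  difference : ∀ z a b → - (z * (a - b)) ≡ (1ℤ - z * a) - (1ℤ - z * b)
  difference = solve-∀
  contracts : ∀ a b → d * (a - b) ∣ (1ℤ - z * a) - (1ℤ - z * b)
  contracts a b = subst (d * (a - b) ∣_) (difference z a b) (∣m⇒∣-m (*-monoˡ-∣ (a - b) d∣z))
  inverse-error : ∀ x s → - ((1ℤ - (x * x - 1ℤ) * s) - s) ≡ x * (x * s) - 1ℤ
  inverse-error = solve-∀

2∣x²-1 : ∀ x → ¬ + 2 ∣ x → + 2 ∣ x * x - 1ℤ
2∣x²-1 = by-residue 2 (λ x → ¬ + 2 ∣ x → + 2 ∣ x * x - 1ℤ) cases
  where
  cases : ∀ r q → r ℕ.< 2 → ¬ + 2 ∣ + r + q * + 2 → + 2 ∣ (+ r + q * + 2) * (+ r + q * + 2) - 1ℤ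
  cases 0 q _ 2∤x = contradiction (∣m∣n⇒∣m+n (divides 0ℤ refl) (∣n⇒∣m*n q ∣-refl)) 2∤x
  cases 1 q _ _   = divides (q * (1ℤ + q) * + 2) (square q)
    where
    square : ∀ q → (+ 1 + q * + 2) * (+ 1 + q * + 2) - 1ℤ ≡ q * (1ℤ + q) * + 2 * + 2
    square = solve-∀
  cases (suc (suc _)) _ (ℕ.s≤s (ℕ.s≤s ()))

3∣x²-1 : ∀ x → ¬ + 3 ∣ x → + 3 ∣ x * x - 1ℤ
3∣x²-1 = by-residue 3 (λ x → ¬ + 3 ∣ x → + 3 ∣ x * x - 1ℤ) cases
  where
  cases : ∀ r q → r ℕ.< 3 → ¬ + 3 ∣ + r + q * + 3 → + 3 ∣ (+ r + q * + 3) * (+ r + q * + 3) - 1ℤ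
  cases 0 q _ 3∤x = contradiction (∣m∣n⇒∣m+n (divides 0ℤ refl) (∣n⇒∣m*n q ∣-refl)) 3∤x
  cases 1 q _ _   = divides (q * (+ 2 + q * + 3)) (square q)
    where
    square : ∀ q → (+ 1 + q * + 3) * (+ 1 + q * + 3) - 1ℤ ≡ q * (+ 2 + q * + 3) * + 3
    square = solve-∀
  cases 2 q _ _   = divides ((1ℤ + q) * (1ℤ + q * + 3)) (square q)
    where
    square : ∀ q → (+ 2 + q * + 3) * (+ 2 + q * + 3) - 1ℤ ≡ (1ℤ + q) * (1ℤ + q * + 3) * + 3
    square = solve-∀
  cases (suc (suc (suc _))) _ (ℕ.s≤s (ℕ.s≤s (ℕ.s≤s ())))

invertible-mod-2^a*3^b : ∀ a b x → (0 ℕ.< a → ¬ + 2 ∣ x) → (0 ℕ.< b → ¬ + 3 ∣ x) →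
                         InvertibleMod ((+ 2) ^ a * (+ 3) ^ b) x
invertible-mod-2^a*3^b zero zero x _ _ = 0ℤ , 1∣ _
invertible-mod-2^a*3^b a@(suc _) zero x 2∤x _ =
  invertible-mod-∣ {x = x} (∣-reflexive (*-identityʳ ((+ 2) ^ a)))
    (invertible-mod-^ (+ 2) x (2∣x²-1 x (2∤x ℕ.z<s)) a)
invertible-mod-2^a*3^b zero b@(suc _) x _ 3∤x =
  invertible-mod-∣ {x = x} (∣-reflexive (*-identityˡ ((+ 3) ^ b)))
    (invertible-mod-^ (+ 3) x (3∣x²-1 x (3∤x ℕ.z<s)) b)
invertible-mod-2^a*3^b a@(suc _) b@(suc _) x 2∤x 3∤x =
  invertible-mod-∣ {x = x} (2^a*3^b∣6^[a+b] a b)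
    (invertible-mod-^ (+ 6) x (2∣∧3∣⇒6∣ (2∣x²-1 x (2∤x ℕ.z<s)) (3∣x²-1 x (3∤x ℕ.z<s))) (a ℕ.+ b))

-- With v an inverse of x, a fixed point of the 6-adic contraction y ↦ vr − 6My² solves
-- y(1 + 6My) ≡ vr.
x*y[1+6My]≡r-solvable : ∀ {e} n x M r → e ∣ (+ 6) ^ n → InvertibleMod e x →
                        ∃ λ y → e ∣ r - x * (y * (1ℤ + + 6 * M * y))
x*y[1+6My]≡r-solvable {e} n x M r e∣6^n (v , e∣xv-1) =
  let y , 6^n∣ = approximate-fixed-point (λ y → v * r - + 6 * M * (y * y)) (+ 6) contracts n
  in y , subst (e ∣_) (error x v y r M)
               (∣m∣n⇒∣m+n (∣m⇒∣m*n (- r) e∣xv-1) (∣n⇒∣m*n x (∣-trans e∣6^n 6^n∣)))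
  where
  difference : ∀ v r M a b → (v * r - + 6 * M * (a * a)) - (v * r - + 6 * M * (b * b))
                             ≡ - (M * (a + b)) * (+ 6 * (a - b))
  difference = solve-∀
  contracts : ∀ a b → + 6 * (a - b) ∣ (v * r - + 6 * M * (a * a)) - (v * r - + 6 * M * (b * b))
  contracts a b = divides (- (M * (a + b))) (difference v r M a b)
  error : ∀ x v y r M → (x * v - 1ℤ) * (- r) + x * ((v * r - + 6 * M * (y * y)) - y)
                        ≡ r - x * (y * (1ℤ + + 6 * M * y))
  error = solve-∀

split-^-⊓ : ∀ p r u w →
            ∃₂ λ w' a → p ^ r * w ≡ p ^ (r ⊓ u) * w' × u ≡ r ⊓ u ℕ.+ a × (0 ℕ.< a → w' ≡ w)
split-^-⊓ p zero    u       w = w , u , refl , refl , λ _ → refl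
split-^-⊓ p (suc r) zero    w = p ^ suc r * w , 0 , sym (*-identityˡ (p ^ suc r * w)) , refl , λ ()
split-^-⊓ p (suc r) (suc u) w =
  let w' , a , p^r*w≡ , u≡ , w'≡w = split-^-⊓ p r u w
  in w' , a ,
     trans (*-assoc p (p ^ r) w) (trans (cong (p *_) p^r*w≡) (sym (*-assoc p (p ^ (r ⊓ u)) w'))) ,
     cong suc u≡ , w'≡w

TwoScaling : ℤ → ℕ → ℕ → Set
TwoScaling c α u =
  ∃ λ e → ∃₂ λ w a → c * (+ 2) ^ e ≡ (+ 2) ^ α * w × u ≡ α ℕ.+ a × (0 ℕ.< a → ¬ + 2 ∣ w)

two-scaling-odd : ∀ {c} r u w → c ≡ (+ 2) ^ r * w → ¬ + 2 ∣ w → TwoScaling c (r ⊓ u) u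
two-scaling-odd {c} r u w c≡2^r*w 2∤w =
  let w' , a , 2^r*w≡ , u≡ , w'≡w = split-^-⊓ (+ 2) r u w
  in 0 , w' , a , trans (*-identityʳ c) (trans c≡2^r*w 2^r*w≡) , u≡ ,
     λ 0<a → subst (λ w → ¬ + 2 ∣ w) (sym (w'≡w 0<a)) 2∤w

2∤2k+3^s*B' : ∀ s k {B'} → ¬ + 2 ∣ B' → ¬ + 2 ∣ + 2 * k + (+ 3) ^ s * B'
2∤2k+3^s*B' s k 2∤B' 2∣ =
  ∤-* prime[2] (∤-^ prime[2] s 2∤3) 2∤B' (∣m+n∣m⇒∣n 2∣ (∣m⇒∣m*n k ∣-refl))

-- For r ≤ 2, 2^r is the exact power of 2 dividing 24t + 2^r 3^s B'; for r ≥ 3 we scale by 2^u.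
two-scaling-24t+B : ∀ t r s B' u → ¬ + 2 ∣ B' →
                    TwoScaling (+ 24 * t + (+ 2) ^ r * (+ 3) ^ s * B') (alpha r u) u
two-scaling-24t+B t 0 s B' u 2∤B' =
  two-scaling-odd 0 u _ (factor t ((+ 3) ^ s) B') (2∤2k+3^s*B' s (+ 12 * t) 2∤B')
  where
  factor : ∀ t T B' → + 24 * t + (+ 2) ^ 0 * T * B' ≡ (+ 2) ^ 0 * (+ 2 * (+ 12 * t) + T * B')
  factor = solve-∀
two-scaling-24t+B t 1 s B' u 2∤B' =
  two-scaling-odd 1 u _ (factor t ((+ 3) ^ s) B') (2∤2k+3^s*B' s (+ 6 * t) 2∤B')
  where
  factor : ∀ t T B' → + 24 * t + (+ 2) ^ 1 * T * B' ≡ (+ 2) ^ 1 * (+ 2 * (+ 6 * t) + T * B')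
  factor = solve-∀
two-scaling-24t+B t 2 s B' u 2∤B' =
  two-scaling-odd 2 u _ (factor t ((+ 3) ^ s) B') (2∤2k+3^s*B' s (+ 3 * t) 2∤B')
  where
  factor : ∀ t T B' → + 24 * t + (+ 2) ^ 2 * T * B' ≡ (+ 2) ^ 2 * (+ 2 * (+ 3 * t) + T * B')
  factor = solve-∀
two-scaling-24t+B t r@(suc (suc (suc _))) s B' u _ =
  u , c , 0 , *-comm c ((+ 2) ^ u) , sym (ℕ.+-identityʳ u) , λ ()
  where
  c = + 24 * t + (+ 2) ^ r * (+ 3) ^ s * B'

scale-24t+B : ∀ t r s B' u v → ¬ + 2 ∣ B' → ¬ + 3 ∣ B' →
  ∃₂ λ P W → ∃₂ λ a b →
      (+ 24 * t + (+ 2) ^ r * (+ 3) ^ s * B') * P ≡ (+ 2) ^ alpha r u * (+ 3) ^ beta s v * W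
    × u ≡ alpha r u ℕ.+ a × v ≡ beta s v ℕ.+ b
    × (0 ℕ.< a → ¬ + 2 ∣ W) × (0 ℕ.< b → ¬ + 3 ∣ W)
scale-24t+B t r zero B' u v 2∤B' 3∤B' =
  let e , W , a , c*2^e≡ , u≡ , 2∤W = two-scaling-24t+B t r 0 B' u 2∤B'
  in (+ 2) ^ e , W , a , v , trans c*2^e≡ (cong (_* W) (sym (*-identityʳ ((+ 2) ^ alpha r u)))) ,
     u≡ , refl , 2∤W ,
     λ _ 3∣W → ∤-* prime[3] 3∤c (∤-^ prime[3] e 3∤2)
                 (subst (+ 3 ∣_) (sym c*2^e≡) (∣n⇒∣m*n ((+ 2) ^ alpha r u) 3∣W))
  where
  c = + 24 * t + (+ 2) ^ r * (+ 3) ^ 0 * B'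
  3∤c : ¬ + 3 ∣ c
  3∤c 3∣c = ∤-* prime[3] (∤-* prime[3] (∤-^ prime[3] r 3∤2) (p∤1 prime[3])) 3∤B'
              (∣m+n∣m⇒∣n 3∣c (∣m⇒∣m*n t (divides (+ 8) refl)))
scale-24t+B t r s@(suc _) B' u v 2∤B' _ =
  let e , W , a , c*2^e≡ , u≡ , 2∤W = two-scaling-24t+B t r s B' u 2∤B'
  in (+ 2) ^ e * (+ 3) ^ v , W , a , 0 ,
     rescale c ((+ 2) ^ e) ((+ 2) ^ alpha r u) W ((+ 3) ^ v) c*2^e≡ ,
     u≡ , sym (ℕ.+-identityʳ v) , 2∤W , λ ()
  where
  c = + 24 * t + (+ 2) ^ r * (+ 3) ^ s * B'
  swap : ∀ A W T → A * W * T ≡ A * T * W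
  swap = solve-∀
  rescale : ∀ c E A W T → c * E ≡ A * W → c * (E * T) ≡ A * T * W
  rescale c E A W T c*E≡A*W = begin
    c * (E * T)  ≡⟨ *-assoc c E T ⟨
    c * E * T    ≡⟨ cong (_* T) c*E≡A*W ⟩
    A * W * T    ≡⟨ swap A W T ⟩
    A * T * W    ∎
    where open ≡-Reasoning

split-2^u*3^v : ∀ {u v} α β a b m' → u ≡ α ℕ.+ a → v ≡ β ℕ.+ b →
                 (+ 2) ^ u * (+ 3) ^ v * m' ≡ (+ 2) ^ α * (+ 3) ^ β * m' * ((+ 2) ^ a * (+ 3) ^ b)
split-2^u*3^v α β a b m' refl refl =
  trans (cong₂ (λ x y → x * y * m') (^-distribˡ-+-* (+ 2) α a) (^-distribˡ-+-* (+ 3) β b))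
        (regroup ((+ 2) ^ α) ((+ 2) ^ a) ((+ 3) ^ β) ((+ 3) ^ b) m')
  where
  regroup : ∀ A A' T T' m' → A * A' * (T * T') * m' ≡ A * T * m' * (A' * T')
  regroup = solve-∀

[[1+12j]²-1]/24≡j[1+6j] : ∀ j → ((1ℤ + + 12 * j) ^ 2 - 1ℤ) / + 24 ≡ j * (1ℤ + + 6 * j)
[[1+12j]²-1]/24≡j[1+6j] j = trans (cong (_/ + 24) (square j)) (i*d/d≡i (j * (1ℤ + + 6 * j)) 24)
  where
  square : ∀ k → (1ℤ + + 12 * k) * ((1ℤ + + 12 * k) * 1ℤ) - 1ℤ ≡ k * (1ℤ + + 6 * k) * + 24
  square = solve-∀

target-at-1+12j : ∀ t λ' B G m' P W N' Y → (+ 24 * t + B) * P ≡ G * W →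
  let j = m' * P * N' * Y ; a = 1ℤ + + 12 * j in
  (t + λ' * (G * m')) - (t * a ^ 2 + B * ((a ^ 2 - 1ℤ) / + 24))
    ≡ G * m' * (λ' - W * N' * (Y * (1ℤ + + 6 * (m' * P * N') * Y)))
target-at-1+12j t λ' B G m' P W N' Y [24t+B]P≡GW = begin
  (t + λ' * (G * m')) - (t * a ^ 2 + B * ((a ^ 2 - 1ℤ) / + 24))
    ≡⟨ cong (λ k → (t + λ' * (G * m')) - (t * a ^ 2 + B * k)) ([[1+12j]²-1]/24≡j[1+6j] j) ⟩
  (t + λ' * (G * m')) - (t * a ^ 2 + B * (j * (1ℤ + + 6 * j)))
    ≡⟨ expand t λ' B G m' P N' Y ⟩
  G * m' * λ' - (+ 24 * t + B) * P * (m' * N' * Y * (1ℤ + + 6 * j))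
    ≡⟨ cong (λ c → G * m' * λ' - c * (m' * N' * Y * (1ℤ + + 6 * j))) [24t+B]P≡GW ⟩
  G * m' * λ' - G * W * (m' * N' * Y * (1ℤ + + 6 * j))
    ≡⟨ collect G m' λ' W P N' Y ⟩
  G * m' * (λ' - W * N' * (Y * (1ℤ + + 6 * (m' * P * N') * Y)))
    ∎
  where
  open ≡-Reasoning
  j = m' * P * N' * Y
  a = 1ℤ + + 12 * j
  expand : ∀ t λ' B G m' P N' Y → let j = m' * P * N' * Y in
    (t + λ' * (G * m')) - (t * ((1ℤ + + 12 * j) * ((1ℤ + + 12 * j) * 1ℤ)) + B * (j * (1ℤ + + 6 * j)))
      ≡ G * m' * λ' - (+ 24 * t + B) * P * (m' * N' * Y * (1ℤ + + 6 * j))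
  expand = solve-∀
  collect : ∀ G m' λ' W P N' Y → let j = m' * P * N' * Y in
    G * m' * λ' - G * W * (m' * N' * Y * (1ℤ + + 6 * j))
      ≡ G * m' * (λ' - W * N' * (Y * (1ℤ + + 6 * (m' * P * N') * Y)))
  collect = solve-∀

gcd[1+12j,6mN]≡1 : ∀ {j m' N' m N} u v x y →
  m ≡ (+ 2) ^ u * (+ 3) ^ v * m' → N ≡ (+ 2) ^ x * (+ 3) ^ y * N' → m' ∣ j → N' ∣ j →
  gcd (1ℤ + + 12 * j) (+ 6 * m * N) ≡ 1ℤ
gcd[1+12j,6mN]≡1 {j} {m'} {N'} {m} {N} u v x y refl refl m'∣j N'∣j =
  coprime⇒gcd≡1 a (+ 6 * m * N) (coprime-* a (+ 6 * m) N (coprime-* a (+ 6) m a⊥6 a⊥m) a⊥N)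
  where
  a = 1ℤ + + 12 * j
  a⊥ : ∀ c → c ∣ + 12 * j → Coprime a c
  a⊥ c = coprime-1+ (+ 12 * j) c
  a⊥2 = a⊥ (+ 2) (∣m⇒∣m*n j (divides (+ 6) refl))
  a⊥3 = a⊥ (+ 3) (∣m⇒∣m*n j (divides (+ 4) refl))
  a⊥6 = a⊥ (+ 6) (∣m⇒∣m*n j (divides (+ 2) refl))
  a⊥m = coprime-2^u*3^v* a m' u v a⊥2 a⊥3 (a⊥ m' (∣n⇒∣m*n (+ 12) m'∣j))
  a⊥N = coprime-2^u*3^v* a N' x y a⊥2 a⊥3 (a⊥ N' (∣n⇒∣m*n (+ 12) N'∣j))

-- The construction works for every integer λ'.
lemma2p2 : (m t B N : ℤ) → 0ℤ < m → 0ℤ < N → B ≢ 0ℤ →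
           (u v : ℕ) (m' : ℤ) → m ≡ (+ 2) ^ u * (+ 3) ^ v * m' → gcd m' (+ 6) ≡ 1ℤ →
           (r s : ℕ) (B' : ℤ) → B ≡ (+ 2) ^ r * (+ 3) ^ s * B' → gcd B' (+ 6) ≡ 1ℤ →
           (λ' : ℤ) → 0ℤ ≤ λ' → λ' * Q u v r s m' < m →
           ∃ λ (a : ℤ) → gcd a ((+ 6) * m * N) ≡ 1ℤ ×
             m Unsigned.∣ ((t + λ' * Q u v r s m') - (t * a ^ 2 + B * ((a ^ 2 - 1ℤ) / (+ 24))))
lemma2p2 m t B N _ 0<N _ u v m' m≡ _ r s B' refl gcd[B',6]≡1 λ' _ _ =
  let x , y , N' , N≡ , 2∤N' , 3∤N' = 6-free-part N (λ N≡0 → <⇒≢ 0<N (sym N≡0))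
      P , W , a , b , [24t+B]P≡GW , u≡ , v≡ , 2∤W , 3∤W =
        scale-24t+B t r s B' u v (gcd≡1⇒∤ B' (+ 6) 2 prime[2] (divides (+ 3) refl) gcd[B',6]≡1)
                                 (gcd≡1⇒∤ B' (+ 6) 3 prime[3] (divides (+ 2) refl) gcd[B',6]≡1)
      Y , E∣λ'-WN'Y[1+6MY] =
        x*y[1+6My]≡r-solvable (a ℕ.+ b) (W * N') (m' * P * N') λ' (2^a*3^b∣6^[a+b] a b)
          (invertible-mod-2^a*3^b a b (W * N') (λ 0<a → ∤-* prime[2] (2∤W 0<a) 2∤N')
                                               (λ 0<b → ∤-* prime[3] (3∤W 0<b) 3∤N'))
      G = (+ 2) ^ alpha r u * (+ 3) ^ beta s v
      j = m' * P * N' * Y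
  in 1ℤ + + 12 * j ,
     gcd[1+12j,6mN]≡1 u v x y m≡ N≡ (∣m⇒∣m*n Y (∣m⇒∣m*n N' (∣m⇒∣m*n P ∣-refl)))
                                    (∣m⇒∣m*n Y (∣n⇒∣m*n (m' * P) ∣-refl)) ,
     ∣⇒∣ᵤ (subst₂ _∣_ (sym (trans m≡ (split-2^u*3^v (alpha r u) (beta s v) a b m' u≡ v≡)))
                      (sym (target-at-1+12j t λ' _ G m' P W N' Y [24t+B]P≡GW))
                      (*-monoʳ-∣ (G * m') E∣λ'-WN'Y[1+6MY]))
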